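{- Let $G$ be a loopless graph without multiple edges, let $v$ be a non-isolated vertex of $G$, and let $G'''$ be obtained from $G$ by adding a true twin $w$ of $v$, i.e. a new vertex $w$ adjacent to $v$ and to exactly the neighbors of $v$. Then $$q(G''';x,y)=2q(G;x,y)+\bigl((x-1)^2-1\bigr)q(G-v;x,y).$$
   Context: The two-variable interlace polynomial of a graph $K$ is $q(K;x,y)=\sum_{S\subseteq V(K)}(x-1)^{r(K[S])}(y-1)^{n(K[S])}$, where $r(K[S])$ and $n(K[S])=|S|-r(K[S])$ are the $\mathbb{F}_2$-rank and nullity of the adjacency matrix of the induced subgraph $K[S]$ (the empty set contributing $1$). -}

module Defs where

open import Level using (Level)
open import Data.Bool using (Bool; true; false; _∧_; _∨_; _xor_; not; if_then_else_)
open import Data.Nat using (ℕ; zero; suc; _∸_; _⊔_)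
open import Data.Fin using (Fin; zero; suc; punchIn)
open import Data.Fin.Subset using (Subset; inside; outside; ∣_∣)
open import Data.Vec using (Vec; []; _∷_; lookup)
open import Data.List using (List; []; _∷_; _++_; map; foldr)
open import Data.Product using (∃; _,_)
open import Relation.Binary.PropositionalEquality using (_≡_; refl)
open import Algebra.Bundles using (CommutativeRing)

record Graph (n : ℕ) : Set where
  field
    adj      : Fin n → Fin n → Bool
    symmetric : ∀ i j → adj i j ≡ adj j i
    loopless : ∀ i → adj i i ≡ false
open Graph public

NonIsolated : ∀ {n} → Graph n → Fin n → Set
NonIsolated G v = ∃ λ u → adj G v u ≡ true

_─_ : ∀ {m} → Graph (suc m) → Fin (suc m) → Graph m
G ─ v = record
  { adj = λ i j → adj G (punchIn v i) (punchIn v j)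
  ; symmetric = λ i j → symmetric G (punchIn v i) (punchIn v j)
  ; loopless = λ i → loopless G (punchIn v i)
  }

-- G''' : add a true twin w of v.  The new vertex w is index zero, and the
-- old vertex i of G becomes suc i.  w is adjacent to v and to exactly the
-- neighbours of v.
twinAdj : ∀ {m} → Graph m → Fin m → Fin (suc m) → Fin (suc m) → Bool
twinAdj G v zero    zero    = false
twinAdj G v zero    (suc j) = isV v j ∨ adj G v j
  where
  isV : ∀ {k} → Fin k → Fin k → Bool
  isV zero    zero    = true
  isV zero    (suc _) = false
  isV (suc _) zero    = false
  isV (suc a) (suc b) = isV a b
twinAdj G v (suc i) zero    = twinAdj G v zero (suc i)
twinAdj G v (suc i) (suc j) = adj G i j

addTrueTwin : ∀ {m} → Graph m → Fin m → Graph (suc m)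
addTrueTwin G v = record
  { adj = twinAdj G v
  ; symmetric = sym'
  ; loopless = loop'
  }
  where
  sym' : ∀ i j → twinAdj G v i j ≡ twinAdj G v j i
  sym' zero zero = refl
  sym' zero (suc j) = refl
  sym' (suc i) zero = refl
  sym' (suc i) (suc j) = symmetric G i j
  loop' : ∀ i → twinAdj G v i i ≡ false
  loop' zero = refl
  loop' (suc i) = loopless G i

allSubsets : ∀ n → List (Subset n)
allSubsets zero    = [] ∷ []
allSubsets (suc n) = map (outside ∷_) (allSubsets n) ++ map (inside ∷_) (allSubsets n)

_∈ᵇ_ : ∀ {n} → Fin n → Subset n → Bool
i ∈ᵇ S = lookup S i

anyFin : ∀ {n} → (Fin n → Bool) → Bool
anyFin {zero}  f = false
anyFin {suc n} f = f zero ∨ anyFin (λ i → f (suc i))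

allFin : ∀ {n} → (Fin n → Bool) → Bool
allFin {zero}  f = true
allFin {suc n} f = f zero ∧ allFin (λ i → f (suc i))

xorFin : ∀ {n} → (Fin n → Bool) → Bool
xorFin {zero}  f = false
xorFin {suc n} f = f zero xor xorFin (λ i → f (suc i))

_⊆ᵇ_ : ∀ {n} → Subset n → Subset n → Bool
U ⊆ᵇ T = allFin (λ i → not (i ∈ᵇ U) ∨ (i ∈ᵇ T))

nonemptyᵇ : ∀ {n} → Subset n → Bool
nonemptyᵇ U = anyFin (λ i → i ∈ᵇ U)

anyL : ∀ {A : Set} → (A → Bool) → List A → Bool
anyL p = foldr (λ a b → p a ∨ b) false

maxL : List ℕ → ℕ
maxL = foldr _⊔_ 0

-- For a Boolean matrix M and row/column set S: the family of rows
-- indexed by T ⊆ S, restricted to the columns in S, is linearly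
-- independent over F₂ iff no nonempty U ⊆ T has zero F₂-sum.
rowsIndependent : ∀ {n} → (Fin n → Fin n → Bool) → Subset n → Subset n → Bool
rowsIndependent M S T =
  not (anyL (λ U → (U ⊆ᵇ T) ∧ nonemptyᵇ U ∧
                   allFin (λ c → not (c ∈ᵇ S) ∨
                                 not (xorFin (λ i → (i ∈ᵇ U) ∧ M i c))))
            (allSubsets _))

-- rank over F₂ of the principal submatrix M[S,S]: the maximal number of
-- linearly independent rows.
rankF2 : ∀ {n} → (Fin n → Fin n → Bool) → Subset n → ℕ
rankF2 M S =
  maxL (map (λ T → if (T ⊆ᵇ S) ∧ rowsIndependent M S T then ∣ T ∣ else 0)
            (allSubsets _))

rk : ∀ {n} → Graph n → Subset n → ℕ
rk K S = rankF2 (adj K) S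

nul : ∀ {n} → Graph n → Subset n → ℕ
nul K S = ∣ S ∣ ∸ rk K S

-- The two-variable interlace polynomial, evaluated at arbitrary x, y in
-- an arbitrary commutative ring R (taking R = ℤ[x,y] recovers the
-- polynomial identity itself).

module _ {c ℓ : Level} (R : CommutativeRing c ℓ) where
  open CommutativeRing R

  pow : Carrier → ℕ → Carrier
  pow a zero    = 1#
  pow a (suc k) = a * pow a k

  _minus1 : Carrier → Carrier
  a minus1 = a + (- 1#)

  q : ∀ {n} → Graph n → Carrier → Carrier → Carrier
  q K x y = foldr (λ S acc → pow (x minus1) (rk K S) * pow (y minus1) (nul K S) + acc)
                  0# (allSubsets _)

-- Split the sum defining q(G''') according to which of v and w lie in S, writing S = S₀ ∪ E with
-- S₀ ⊆ V(G) ∖ v and E ⊆ {v, w}.  For E = ∅ the induced subgraph is (G - v)[S₀]; for E = {v} and for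
-- E = {w} it is a copy of G[S₀ + v].  For E = {v, w}, subtracting row and column w from those of v
-- leaves an invertible block [[0,1],[1,0]] on {v, w}, so the rank grows by 2 and the nullity is
-- that of (G - v)[S₀].  Hence the summands with E = ∅ or E = {v, w} add up to (1 + (x-1)²) q(G - v),
-- and the two others each to q(G) - q(G - v).
-- Ranks are taken as in their definition, as maximal sizes of F₂-independent row sets, so each rank
-- identity is proved by transporting independent row sets in both directions.
module Submission where

open import Defs
open import Level using (Level)
open import Algebra.Bundles using (CommutativeMonoid; CommutativeRing)
open import Data.Bool using (Bool; true; false; _∧_; _∨_; _xor_; not; if_then_else_)
open import Data.Bool.Properties
  using (xor-∧-commutativeRing; ∧-zeroʳ; ∧-identityʳ; ∧-distribʳ-xor; xor-identityʳ; not-involutive; ∨-zeroʳ)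
open import Data.Empty using (⊥-elim)
open import Data.Fin.Subset using (Subset; ∣_∣)
open import Data.Vec using ([]; _∷_; lookup; tabulate; insertAt)
open import Data.Vec.Properties using (lookup∘tabulate; insertAt-lookup; insertAt-punchIn)
open import Data.List using (List; []; _∷_; _++_; map; foldr)
open import Data.List.Properties using (foldr-map)
open import Data.List.Membership.Propositional using (_∈_)
open import Data.List.Membership.Propositional.Properties using (∈-map⁺; ∈-map⁻; ∈-++⁺ˡ; ∈-++⁺ʳ)
open import Data.List.Relation.Unary.Any using (here; there)
open import Data.Fin as Fin using (Fin; zero; suc; punchIn; punchOut; _≟_)
open import Data.Fin.Properties using (suc-injective; punchInᵢ≢i; punchIn-injective; punchIn-punchOut)
open import Data.Nat using (ℕ; zero; suc; _∸_)
open import Data.Product using (∃; _×_; _,_; proj₁; proj₂)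
open import Data.Sum using (_⊎_; inj₁; inj₂; map₁)
open import Function using (_∘_)
open import Relation.Nullary using (yes; no; does; contradiction)
open import Relation.Nullary.Decidable using (dec-true; dec-false)
open import Relation.Binary.PropositionalEquality as ≡ using (_≡_; _≢_)

∣insertAt-false∣ : ∀ {m} (S : Subset m) v → ∣ insertAt S v false ∣ ≡ ∣ S ∣
∣insertAt-false∣ S           zero    = ≡.refl
∣insertAt-false∣ (true  ∷ S) (suc v) = ≡.cong suc (∣insertAt-false∣ S v)
∣insertAt-false∣ (false ∷ S) (suc v) = ∣insertAt-false∣ S v

∣insertAt-true∣ : ∀ {m} (S : Subset m) v → ∣ insertAt S v true ∣ ≡ suc ∣ S ∣
∣insertAt-true∣ S           zero    = ≡.refl
∣insertAt-true∣ (true  ∷ S) (suc v) = ≡.cong suc (∣insertAt-true∣ S v)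
∣insertAt-true∣ (false ∷ S) (suc v) = ∣insertAt-true∣ S v

insertAt-other : ∀ {m} (S : Subset m) {v j : Fin (suc m)} (b b' : Bool) → j ≢ v →
                 lookup (insertAt S v b) j ≡ lookup (insertAt S v b') j
insertAt-other S {v} {j} b b' j≢v = begin
  lookup (insertAt S v b) j                           ≡⟨ ≡.cong (lookup (insertAt S v b)) (punchIn-punchOut v≢j) ⟨
  lookup (insertAt S v b) (punchIn v (punchOut v≢j))  ≡⟨ insertAt-punchIn S v b _ ⟩
  lookup S (punchOut v≢j)                             ≡⟨ insertAt-punchIn S v b' _ ⟨
  lookup (insertAt S v b') (punchIn v (punchOut v≢j)) ≡⟨ ≡.cong (lookup (insertAt S v b')) (punchIn-punchOut v≢j) ⟩
  lookup (insertAt S v b') j                          ∎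
  where
  open ≡.≡-Reasoning
  v≢j = j≢v ∘ ≡.sym

insertAt-false-≢ : ∀ {m} (S : Subset m) (v j : Fin (suc m)) → lookup (insertAt S v false) j ≡ true → j ≢ v
insertAt-false-≢ S v j inS ≡.refl = contradiction (≡.trans (≡.sym inS) (insertAt-lookup S v false)) λ ()

module SubsetSums {c ℓ} (R : CommutativeRing c ℓ) where
  open CommutativeRing R
  open import Algebra.Properties.AbelianGroup +-abelianGroup using (xyx⁻¹≈y)
  open import Algebra.Solver.CommutativeMonoid +-commutativeMonoid using (solve; _⊕_; _⊜_)
  open import Relation.Binary.Reasoning.Setoid setoid

  sumList : ∀ {A : Set} → (A → Carrier) → List A → Carrier
  sumList f = foldr (λ a acc → f a + acc) 0#

  sumList-cong : ∀ {A : Set} {f g : A → Carrier} → (∀ a → f a ≈ g a) → ∀ xs → sumList f xs ≈ sumList g xs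
  sumList-cong f≈g []       = refl
  sumList-cong f≈g (x ∷ xs) = +-cong (f≈g x) (sumList-cong f≈g xs)

  sumList-++ : ∀ {A : Set} (f : A → Carrier) xs ys → sumList f (xs ++ ys) ≈ sumList f xs + sumList f ys
  sumList-++ f []       ys = sym (+-identityˡ _)
  sumList-++ f (x ∷ xs) ys = trans (+-congˡ (sumList-++ f xs ys)) (sym (+-assoc _ _ _))

  sumList-+ : ∀ {A : Set} (f g : A → Carrier) xs → sumList (λ a → f a + g a) xs ≈ sumList f xs + sumList g xs
  sumList-+ f g []       = sym (+-identityˡ _)
  sumList-+ f g (x ∷ xs) = trans (+-congˡ (sumList-+ f g xs))
    (solve 4 (λ a b c d → (a ⊕ b) ⊕ (c ⊕ d) ⊜ (a ⊕ c) ⊕ (b ⊕ d)) refl (f x) (g x) (sumList f xs) (sumList g xs))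

  sumList-*ˡ : ∀ {A : Set} k (f : A → Carrier) xs → sumList (λ a → k * f a) xs ≈ k * sumList f xs
  sumList-*ˡ k f []       = sym (zeroʳ k)
  sumList-*ˡ k f (x ∷ xs) = trans (+-congˡ (sumList-*ˡ k f xs)) (sym (distribˡ k (f x) _))

  ∑ : ∀ {n} → (Subset n → Carrier) → Carrier
  ∑ f = sumList f (allSubsets _)

  ∑-split-head : ∀ {n} (f : Subset (suc n) → Carrier) → ∑ f ≈ ∑ (λ S → f (false ∷ S) + f (true ∷ S))
  ∑-split-head {n} f = begin
    sumList f (map (false ∷_) (allSubsets n) ++ map (true ∷_) (allSubsets n))
      ≈⟨ sumList-++ f (map (false ∷_) (allSubsets n)) _ ⟩
    sumList f (map (false ∷_) (allSubsets n)) + sumList f (map (true ∷_) (allSubsets n))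
      ≡⟨ ≡.cong₂ _+_ (foldr-map _ (false ∷_) 0# (allSubsets n)) (foldr-map _ (true ∷_) 0# (allSubsets n)) ⟩
    ∑ (λ S → f (false ∷ S)) + ∑ (λ S → f (true ∷ S))
      ≈⟨ sumList-+ _ _ (allSubsets n) ⟨
    ∑ (λ S → f (false ∷ S) + f (true ∷ S)) ∎

  ∑-split-at : ∀ {n} (v : Fin (suc n)) (f : Subset (suc n) → Carrier) →
               ∑ f ≈ ∑ (λ S → f (insertAt S v false) + f (insertAt S v true))
  ∑-split-at zero f = ∑-split-head f
  ∑-split-at {suc n} (suc v) f = begin
    ∑ f                                                   ≈⟨ ∑-split-head f ⟩
    ∑ (λ S → f (false ∷ S) + f (true ∷ S))                ≈⟨ sumList-+ _ _ (allSubsets (suc n)) ⟩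
    ∑ (λ S → f (false ∷ S)) + ∑ (λ S → f (true ∷ S))      ≈⟨ +-cong (∑-split-at v _) (∑-split-at v _) ⟩
    ∑ (λ S → f (false ∷ insertAt S v false) + f (false ∷ insertAt S v true)) +
    ∑ (λ S → f (true ∷ insertAt S v false) + f (true ∷ insertAt S v true))
                                                          ≈⟨ sumList-+ _ _ (allSubsets n) ⟨
    ∑ (λ S → (f (false ∷ insertAt S v false) + f (false ∷ insertAt S v true)) +
             (f (true ∷ insertAt S v false) + f (true ∷ insertAt S v true)))
                          ≈⟨ ∑-split-head (λ S → f (insertAt S (suc v) false) + f (insertAt S (suc v) true)) ⟨
    ∑ (λ S → f (insertAt S (suc v) false) + f (insertAt S (suc v) true)) ∎

  twin-identity : ∀ X t a → (t + a) + (a + X * (X * t)) ≈ (1# + 1#) * (t + a) + (pow R X 2 + - 1#) * t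
  twin-identity X t a = sym (begin
    (1# + 1#) * (t + a) + (pow R X 2 + - 1#) * t    ≈⟨ +-cong (distribʳ (t + a) 1# 1#) (distribʳ t (pow R X 2) (- 1#)) ⟩
    (1# * (t + a) + 1# * (t + a)) + (pow R X 2 * t + - 1# * t)
      ≈⟨ +-cong (+-cong (*-identityˡ _) (*-identityˡ _)) (+-cong X²t≈XXt (-1*x≈-x t)) ⟩
    ((t + a) + (t + a)) + (X * (X * t) + - t)         ≈⟨ +-assoc _ _ _ ⟩
    (t + a) + ((t + a) + (X * (X * t) + - t))         ≈⟨ +-congˡ cancel ⟩
    (t + a) + (a + X * (X * t))                       ∎)
    where
    open import Algebra.Properties.Ring ring using (-1*x≈-x)
    X²t≈XXt : pow R X 2 * t ≈ X * (X * t)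
    X²t≈XXt = trans (*-congʳ (*-congˡ (*-identityʳ X))) (*-assoc X X t)
    cancel : (t + a) + (X * (X * t) + - t) ≈ a + X * (X * t)
    cancel = trans (solve 4 (λ t a c n → (t ⊕ a) ⊕ (c ⊕ n) ⊜ (t ⊕ (a ⊕ c)) ⊕ n) refl t a (X * (X * t)) (- t))
                   (xyx⁻¹≈y t _)

  ∑-twin : ∀ {m} (v : Fin (suc m)) X (f₃ : Subset (suc (suc m)) → Carrier) (f : Subset (suc m) → Carrier)
           (f₀ : Subset m → Carrier) →
           (∀ S → f₃ (false ∷ insertAt S v false) ≈ f₀ S) →
           (∀ S → f₃ (true ∷ insertAt S v false) ≈ f (insertAt S v true)) →
           (∀ S → f₃ (false ∷ S) ≈ f S) →
           (∀ S → f₃ (true ∷ insertAt S v true) ≈ X * (X * f₀ S)) →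
           (∀ S → f (insertAt S v false) ≈ f₀ S) →
           ∑ f₃ ≈ (1# + 1#) * ∑ f + (pow R X 2 + - 1#) * ∑ f₀
  ∑-twin {m} v X f₃ f f₀ neither only-w without-w both without-v = begin
    ∑ f₃                                                  ≈⟨ ∑-split-head f₃ ⟩
    ∑ (λ S → f₃ (false ∷ S) + f₃ (true ∷ S))              ≈⟨ ∑-split-at v _ ⟩
    ∑ (λ S → (f₃ (false ∷ Sᵒ S) + f₃ (true ∷ Sᵒ S)) + (f₃ (false ∷ Sⁱ S) + f₃ (true ∷ Sⁱ S)))
                                                          ≈⟨ sumList-cong per-subset (allSubsets m) ⟩
    ∑ (λ S → (1# + 1#) * (f (Sᵒ S) + f (Sⁱ S)) + (pow R X 2 + - 1#) * f₀ S)
                                                          ≈⟨ sumList-+ _ _ (allSubsets m) ⟩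
    ∑ (λ S → (1# + 1#) * (f (Sᵒ S) + f (Sⁱ S))) + ∑ (λ S → (pow R X 2 + - 1#) * f₀ S)
                          ≈⟨ +-cong (sumList-*ˡ _ _ (allSubsets m)) (sumList-*ˡ _ f₀ (allSubsets m)) ⟩
    (1# + 1#) * ∑ (λ S → f (Sᵒ S) + f (Sⁱ S)) + (pow R X 2 + - 1#) * ∑ f₀
                                                          ≈⟨ +-congʳ (*-congˡ (∑-split-at v f)) ⟨
    (1# + 1#) * ∑ f + (pow R X 2 + - 1#) * ∑ f₀           ∎
    where
    Sᵒ Sⁱ : Subset m → Subset (suc m)
    Sᵒ S = insertAt S v false
    Sⁱ S = insertAt S v true
    per-subset : ∀ S → (f₃ (false ∷ Sᵒ S) + f₃ (true ∷ Sᵒ S)) + (f₃ (false ∷ Sⁱ S) + f₃ (true ∷ Sⁱ S))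
                     ≈ (1# + 1#) * (f (Sᵒ S) + f (Sⁱ S)) + (pow R X 2 + - 1#) * f₀ S
    per-subset S = begin
      (f₃ (false ∷ Sᵒ S) + f₃ (true ∷ Sᵒ S)) + (f₃ (false ∷ Sⁱ S) + f₃ (true ∷ Sⁱ S))
        ≈⟨ +-cong (+-cong (neither S) (only-w S)) (+-cong (without-w (Sⁱ S)) (both S)) ⟩
      (f₀ S + f (Sⁱ S)) + (f (Sⁱ S) + X * (X * f₀ S))     ≈⟨ twin-identity X (f₀ S) (f (Sⁱ S)) ⟩
      (1# + 1#) * (f₀ S + f (Sⁱ S)) + (pow R X 2 + - 1#) * f₀ S
        ≈⟨ +-congʳ (*-congˡ (+-congʳ (without-v S))) ⟨
      (1# + 1#) * (f (Sᵒ S) + f (Sⁱ S)) + (pow R X 2 + - 1#) * f₀ S ∎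

  module Interlace (x y : Carrier) where

    term : ∀ {n} → Graph n → Subset n → Carrier
    term K S = pow R (_minus1 R x) (rk K S) * pow R (_minus1 R y) (nul K S)

    term-cong : ∀ {n n'} (K : Graph n) (S : Subset n) (K' : Graph n') (S' : Subset n') →
                rk K S ≡ rk K' S' → ∣ S ∣ ≡ ∣ S' ∣ → term K S ≈ term K' S'
    term-cong K S K' S' r≡r' s≡s' =
      reflexive (≡.cong₂ (λ r s → pow R (_minus1 R x) r * pow R (_minus1 R y) (s ∸ r)) r≡r' s≡s')

    term-+2 : ∀ {n n'} (K : Graph n) (S : Subset n) (K' : Graph n') (S' : Subset n') →
              rk K S ≡ suc (suc (rk K' S')) → ∣ S ∣ ≡ suc (suc ∣ S' ∣) →
              term K S ≈ _minus1 R x * (_minus1 R x * term K' S')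
    term-+2 K S K' S' r≡r' s≡s' =
      trans (reflexive (≡.cong₂ (λ r s → pow R (_minus1 R x) r * pow R (_minus1 R y) (s ∸ r)) r≡r' s≡s'))
            (trans (*-assoc _ _ _) (*-congˡ (*-assoc _ _ _)))

    q-twin-recurrence : ∀ {m} (v : Fin (suc m)) (K₃ : Graph (suc (suc m))) (K : Graph (suc m)) (K₀ : Graph m) →
      (∀ S → rk K₃ (false ∷ insertAt S v false) ≡ rk K₀ S) →
      (∀ S → rk K₃ (true ∷ insertAt S v false) ≡ rk K (insertAt S v true)) →
      (∀ S → rk K₃ (false ∷ S) ≡ rk K S) →
      (∀ S → rk K₃ (true ∷ insertAt S v true) ≡ suc (suc (rk K₀ S))) →
      (∀ S → rk K (insertAt S v false) ≡ rk K₀ S) →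
      q R K₃ x y ≈ (1# + 1#) * q R K x y + (pow R (_minus1 R x) 2 + - 1#) * q R K₀ x y
    q-twin-recurrence v K₃ K K₀ r₁ r₂ r₃ r₄ r₅ = ∑-twin v (_minus1 R x) (term K₃) (term K) (term K₀)
      (λ S → term-cong K₃ (false ∷ insertAt S v false) K₀ S (r₁ S) (∣insertAt-false∣ S v))
      (λ S → term-cong K₃ (true ∷ insertAt S v false) K (insertAt S v true) (r₂ S)
               (≡.trans (≡.cong suc (∣insertAt-false∣ S v)) (≡.sym (∣insertAt-true∣ S v))))
      (λ S → term-cong K₃ (false ∷ S) K S (r₃ S) ≡.refl)
      (λ S → term-+2 K₃ (true ∷ insertAt S v true) K₀ S (r₄ S) (≡.cong suc (∣insertAt-true∣ S v)))
      (λ S → term-cong K (insertAt S v false) K₀ S (r₅ S) (∣insertAt-false∣ S v))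

open import Data.Nat using (_+_; _≤_; s≤s)
open ≡ using (refl; cong; cong₂; module ≡-Reasoning)
open import Data.Nat.Properties
  using ( +-0-commutativeMonoid; +-comm; +-identityʳ; n≤1+n; ≤-antisym; +-cancelʳ-≤; ≤-trans; ≤-reflexive
        ; +-monoˡ-≤; m≤m⊔n; m≤n⊔m; ⊔-sel; module ≤-Reasoning)

module FinSum {a ℓ} (M : CommutativeMonoid a ℓ) where
  open CommutativeMonoid M renaming (refl to ≈-refl; sym to ≈-sym; trans to ≈-trans)
  open import Algebra.Properties.CommutativeMonoid.Sum M public using (sum; sum-cong-≗; ∑-distrib-+)
  open import Algebra.Properties.CommutativeMonoid.Sum M
    using (sum-remove; sum-cong-≋; sum-replicate-zero)
  open import Relation.Binary.Reasoning.Setoid setoid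

  sum-vanishing : ∀ {n} (f : Fin n → Carrier) → (∀ i → f i ≈ ε) → sum f ≈ ε
  sum-vanishing {n} f f≈ε = ≈-trans (sum-cong-≋ f≈ε) (sum-replicate-zero n)

  sum-extract : ∀ {n} (p : Fin n) (f g : Fin n → Carrier) →
                g p ≈ ε → (∀ i → i ≢ p → g i ≈ f i) → sum f ≈ f p ∙ sum g
  sum-extract {suc n} p f g gp≈ε g≈f = begin
    sum f                            ≈⟨ sum-remove {i = p} f ⟩
    f p ∙ sum (f ∘ punchIn p)        ≈⟨ ∙-congˡ (sum-cong-≋ λ i → ≈-sym (g≈f _ (punchInᵢ≢i p i))) ⟩
    f p ∙ sum (g ∘ punchIn p)        ≈⟨ ∙-congˡ (≈-sym (identityˡ _)) ⟩
    f p ∙ (ε ∙ sum (g ∘ punchIn p))  ≈⟨ ∙-congˡ (∙-congʳ (≈-sym gp≈ε)) ⟩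
    f p ∙ (g p ∙ sum (g ∘ punchIn p)) ≈⟨ ∙-congˡ (≈-sym (sum-remove {i = p} g)) ⟩
    f p ∙ sum g                      ∎

  sum-reindex : ∀ {m n} (e : Fin m → Fin n) → (∀ {i j} → e i ≡ e j → i ≡ j) →
                (f : Fin n → Carrier) → (∀ j → f j ≈ ε ⊎ ∃ λ i → e i ≡ j) →
                sum f ≈ sum (f ∘ e)
  sum-reindex {zero} e _ f f-supp = sum-vanishing f vanishes
    where
    vanishes : ∀ j → f j ≈ ε
    vanishes j with f-supp j
    ... | inj₁ fj≈ε = fj≈ε
    ... | inj₂ (() , _)
  sum-reindex {suc m} {n} e e-inj f f-supp = begin
    sum f                  ≈⟨ sum-extract p f g g-at g-off ⟩
    f p ∙ sum g            ≈⟨ ∙-congˡ (sum-reindex (e ∘ suc) (suc-injective ∘ e-inj) g g-supp) ⟩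
    f p ∙ sum (g ∘ e ∘ suc) ≈⟨ ∙-congˡ (sum-cong-≋ λ i → g-off (e (suc i)) (suc≢zero ∘ e-inj)) ⟩
    sum (f ∘ e)            ∎
    where
    p = e zero
    g : Fin n → Carrier
    g j = if does (j ≟ p) then ε else f j
    g-at : g p ≈ ε
    g-at with p ≟ p
    ... | yes _ = ≈-refl
    ... | no p≢p = ⊥-elim (p≢p refl)
    g-off : ∀ j → j ≢ p → g j ≈ f j
    g-off j j≢p with j ≟ p
    ... | yes j≡p = ⊥-elim (j≢p j≡p)
    ... | no _ = ≈-refl
    suc≢zero : ∀ {i : Fin m} → Fin.suc i ≢ zero
    suc≢zero ()
    g-supp : ∀ j → g j ≈ ε ⊎ ∃ λ i → e (suc i) ≡ j
    g-supp j with j ≟ p | f-supp j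
    ... | yes _ | _ = inj₁ ≈-refl
    ... | no _ | inj₁ fj≈ε = inj₁ fj≈ε
    ... | no j≢p | inj₂ (Fin.zero , refl) = ⊥-elim (j≢p refl)
    ... | no _ | inj₂ (Fin.suc i , eq) = inj₂ (i , eq)

module XorSum = FinSum (CommutativeRing.+-commutativeMonoid xor-∧-commutativeRing)
module NatSum = FinSum +-0-commutativeMonoid

xorFin≡sum : ∀ {n} (f : Fin n → Bool) → xorFin f ≡ XorSum.sum f
xorFin≡sum {zero}  f = refl
xorFin≡sum {suc n} f = cong (f zero xor_) (xorFin≡sum (f ∘ suc))

xorFin-true : ∀ {n} (f : Fin n → Bool) → xorFin f ≡ true → ∃ λ i → f i ≡ true
xorFin-true {suc n} f sum≡true with f zero in f0
... | true  = zero , f0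
... | false = let i , fi = xorFin-true (f ∘ suc) sum≡true in suc i , fi

xor-cases : ∀ a b c → b xor c ≡ true ⊎ a xor c ≡ true ⊎ (a ≡ c × b ≡ c)
xor-cases true  true  true  = inj₂ (inj₂ (refl , refl))
xor-cases false false false = inj₂ (inj₂ (refl , refl))
xor-cases a     true  false = inj₁ refl
xor-cases a     false true  = inj₁ refl
xor-cases true  false false = inj₂ (inj₁ refl)
xor-cases false true  true  = inj₂ (inj₁ refl)

xor-cancel : ∀ a b → a xor (a xor b) ≡ b
xor-cancel false b = refl
xor-cancel true  b = not-involutive b

Sub : ℕ → Set
Sub n = Fin n → Bool

infix 4 _⊆_
infixl 6 _∖_

_⊆_ : ∀ {n} → Sub n → Sub n → Set
U ⊆ T = ∀ i → U i ≡ true → T i ≡ true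

≗⇒⊆ : ∀ {n} {U T : Sub n} → (∀ i → U i ≡ T i) → U ⊆ T
≗⇒⊆ U≗T i Ui = ≡.trans (≡.sym (U≗T i)) Ui

Nonempty : ∀ {n} → Sub n → Set
Nonempty U = ∃ λ i → U i ≡ true

_∖_ : ∀ {n} → Sub n → Fin n → Sub n
(U ∖ p) j = U j ∧ not (does (j ≟ p))

∖-self : ∀ {n} (U : Sub n) p → (U ∖ p) p ≡ false
∖-self U p with p ≟ p
... | yes _   = ∧-zeroʳ (U p)
... | no p≢p = ⊥-elim (p≢p refl)

∖-other : ∀ {n} (U : Sub n) {p j} → j ≢ p → (U ∖ p) j ≡ U j
∖-other U {p} {j} j≢p with j ≟ p
... | yes j≡p = ⊥-elim (j≢p j≡p)
... | no _    = ∧-identityʳ (U j)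

∖-⊆ : ∀ {n} (U : Sub n) p → U ∖ p ⊆ U
∖-⊆ U p j Uj∖p with U j
... | true = refl

∖-true : ∀ {n} (C : Sub n) {x c} → C c ≡ true → c ≢ x → (C ∖ x) c ≡ true
∖-true C Cc c≢x = ≡.trans (∖-other C c≢x) Cc

insert : ∀ {n} → Fin n → Sub n → Sub n
insert p U j = does (j ≟ p) ∨ U j

insert-self : ∀ {n} (U : Sub n) p → insert p U p ≡ true
insert-self U p = cong (_∨ U p) (dec-true (p ≟ p) refl)

insert-other : ∀ {n} (U : Sub n) {p j} → j ≢ p → insert p U j ≡ U j
insert-other U {p} {j} j≢p = cong (_∨ U j) (dec-false (j ≟ p) j≢p)

insert-⊆ : ∀ {n} (U : Sub n) p → U ⊆ insert p U
insert-⊆ U p j Uj = ≡.trans (cong (does (j ≟ p) ∨_) Uj) (∨-zeroʳ (does (j ≟ p)))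

insert-∖-⊆ : ∀ {n} (U : Sub n) p → insert p U ∖ p ⊆ U
insert-∖-⊆ U p j inserted with j ≟ p
... | yes refl = contradiction inserted λ ()
... | no _     = ≡.trans (≡.sym (∧-identityʳ (U j))) inserted

χ : Bool → ℕ
χ b = if b then 1 else 0

count : ∀ {n} → Sub n → ℕ
count T = NatSum.sum (χ ∘ T)

count-∖ : ∀ {n} (T : Sub n) p → count T ≡ χ (T p) + count (T ∖ p)
count-∖ T p = NatSum.sum-extract p (χ ∘ T) (χ ∘ (T ∖ p))
  (cong χ (∖-self T p)) (λ i i≢p → cong χ (∖-other T i≢p))

card≡count : ∀ {n} (S : Subset n) → ∣ S ∣ ≡ count (lookup S)
card≡count []          = refl
card≡count (true  ∷ S) = cong suc (card≡count S)
card≡count (false ∷ S) = card≡count S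

Matrix : ℕ → Set
Matrix n = Fin n → Fin n → Bool

rowSum : ∀ {n} → Matrix n → Sub n → Fin n → Bool
rowSum M U c = xorFin (λ i → U i ∧ M i c)

rowSum≡sum : ∀ {n} (M : Matrix n) (U : Sub n) c → rowSum M U c ≡ XorSum.sum (λ i → U i ∧ M i c)
rowSum≡sum M U c = xorFin≡sum (λ i → U i ∧ M i c)

rowSum-cong : ∀ {n} (M : Matrix n) {U V : Sub n} → (∀ i → U i ≡ V i) → ∀ c → rowSum M U c ≡ rowSum M V c
rowSum-cong M {U} {V} U≗V c = begin
  rowSum M U c                   ≡⟨ rowSum≡sum M U c ⟩
  XorSum.sum (λ i → U i ∧ M i c) ≡⟨ XorSum.sum-cong-≗ (λ i → cong (_∧ M i c) (U≗V i)) ⟩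
  XorSum.sum (λ i → V i ∧ M i c) ≡⟨ rowSum≡sum M V c ⟨
  rowSum M V c                   ∎
  where open ≡-Reasoning

rowSum-∖ : ∀ {n} (M : Matrix n) (U : Sub n) p c → rowSum M U c ≡ (U p ∧ M p c) xor rowSum M (U ∖ p) c
rowSum-∖ M U p c = begin
  rowSum M U c                                           ≡⟨ rowSum≡sum M U c ⟩
  XorSum.sum (λ i → U i ∧ M i c)                         ≡⟨ XorSum.sum-extract p _ _ removed other ⟩
  (U p ∧ M p c) xor XorSum.sum (λ i → (U ∖ p) i ∧ M i c) ≡⟨ cong ((U p ∧ M p c) xor_) (rowSum≡sum M (U ∖ p) c) ⟨
  (U p ∧ M p c) xor rowSum M (U ∖ p) c                   ∎
  where
  open ≡-Reasoning
  removed : (U ∖ p) p ∧ M p c ≡ false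
  removed = cong (_∧ M p c) (∖-self U p)
  other : ∀ i → i ≢ p → (U ∖ p) i ∧ M i c ≡ U i ∧ M i c
  other i i≢p = cong (_∧ M i c) (∖-other U i≢p)

rowSum-xor : ∀ {n} (M : Matrix n) (U V : Sub n) c →
             rowSum M (λ i → U i xor V i) c ≡ rowSum M U c xor rowSum M V c
rowSum-xor M U V c = begin
  rowSum M (λ i → U i xor V i) c
    ≡⟨ rowSum≡sum M _ c ⟩
  XorSum.sum (λ i → (U i xor V i) ∧ M i c)
    ≡⟨ XorSum.sum-cong-≗ (λ i → ∧-distribʳ-xor (M i c) (U i) (V i)) ⟩
  XorSum.sum (λ i → (U i ∧ M i c) xor (V i ∧ M i c))
    ≡⟨ XorSum.∑-distrib-+ (λ i → U i ∧ M i c) (λ i → V i ∧ M i c) ⟩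
  XorSum.sum (λ i → U i ∧ M i c) xor XorSum.sum (λ i → V i ∧ M i c)
    ≡⟨ cong₂ _xor_ (rowSum≡sum M U c) (rowSum≡sum M V c) ⟨
  rowSum M U c xor rowSum M V c
    ∎
  where open ≡-Reasoning

rowSum-nonempty : ∀ {n} (M : Matrix n) (U : Sub n) c → rowSum M U c ≡ true → Nonempty U
rowSum-nonempty M U c sum≡true with xorFin-true (λ i → U i ∧ M i c) sum≡true
... | i , Ui∧Mic with U i in Ui
...   | true = i , Ui

Independent : ∀ {n} → Matrix n → Sub n → Sub n → Set
Independent M C T = ∀ U → U ⊆ T → Nonempty U → ∃ λ c → C c ≡ true × rowSum M U c ≡ true

Dependent : ∀ {n} → Matrix n → Sub n → Sub n → Set
Dependent M C T = ∃ λ U → U ⊆ T × Nonempty U × (∀ c → C c ≡ true → rowSum M U c ≡ false)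

Independent-antitone : ∀ {n} (M : Matrix n) {C T T' : Sub n} → T' ⊆ T → Independent M C T → Independent M C T'
Independent-antitone M T'⊆T ind U U⊆T' = ind U (λ i → T'⊆T i ∘ U⊆T' i)

Independent-monotone : ∀ {n} (M : Matrix n) {C C' T : Sub n} → C ⊆ C' → Independent M C T → Independent M C' T
Independent-monotone M C⊆C' ind U U⊆T U≠∅ =
  let c , Cc , sum≡true = ind U U⊆T U≠∅ in c , C⊆C' c Cc , sum≡true

IndependentIn : ∀ {n} → Matrix n → Sub n → Sub n → Set
IndependentIn M S T = T ⊆ S × Independent M S T

IndependentIn-monotone : ∀ {n} (M : Matrix n) {S S' T : Sub n} → S ⊆ S' → IndependentIn M S T → IndependentIn M S' T
IndependentIn-monotone M S⊆S' (T⊆S , ind) = (λ i → S⊆S' i ∘ T⊆S i) , Independent-monotone M S⊆S' ind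

allFin-true⁻ : ∀ {n} {f : Fin n → Bool} → allFin f ≡ true → ∀ i → f i ≡ true
allFin-true⁻ {f = f} all≡true zero with f zero | all≡true
... | true | _ = refl
allFin-true⁻ {f = f} all≡true (suc i) with f zero | all≡true
... | true | rest = allFin-true⁻ rest i

allFin-true⁺ : ∀ {n} {f : Fin n → Bool} → (∀ i → f i ≡ true) → allFin f ≡ true
allFin-true⁺ {zero}          all = refl
allFin-true⁺ {suc n} {f = f} all rewrite all zero = allFin-true⁺ (all ∘ suc)

allFin-false⁻ : ∀ {n} {f : Fin n → Bool} → allFin f ≡ false → ∃ λ i → f i ≡ false
allFin-false⁻ {suc n} {f} all≡false with f zero in f0
... | false = zero , f0
... | true  = let i , fi = allFin-false⁻ all≡false in suc i , fi

anyFin-true⁻ : ∀ {n} {f : Fin n → Bool} → anyFin f ≡ true → ∃ λ i → f i ≡ true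
anyFin-true⁻ {suc n} {f} any≡true with f zero in f0
... | true  = zero , f0
... | false = let i , fi = anyFin-true⁻ any≡true in suc i , fi

anyFin-true⁺ : ∀ {n} {f : Fin n → Bool} i → f i ≡ true → anyFin f ≡ true
anyFin-true⁺ {f = f} zero    fi rewrite fi = refl
anyFin-true⁺ {f = f} (suc i) fi with f zero
... | true  = refl
... | false = anyFin-true⁺ i fi

allFin-false⁺ : ∀ {n} {f : Fin n → Bool} i → f i ≡ false → allFin f ≡ false
allFin-false⁺ {f = f} zero    fi rewrite fi = refl
allFin-false⁺ {f = f} (suc i) fi with f zero
... | true  = allFin-false⁺ i fi
... | false = refl

anyL-true⁻ : ∀ {A : Set} (p : A → Bool) (xs : List A) → anyL p xs ≡ true → ∃ λ x → p x ≡ true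
anyL-true⁻ p (x ∷ xs) any≡true with p x in px
... | true  = x , px
... | false = anyL-true⁻ p xs any≡true

anyL-false⁻ : ∀ {A : Set} (p : A → Bool) {xs : List A} → anyL p xs ≡ false → ∀ {x} → x ∈ xs → p x ≡ false
anyL-false⁻ p {y ∷ _} any≡false (here refl) with p y
... | false = refl
anyL-false⁻ p {y ∷ _} any≡false (there x∈xs) with p y
... | false = anyL-false⁻ p any≡false x∈xs

anyL-false⁺ : ∀ {A : Set} (p : A → Bool) (xs : List A) → (∀ x → p x ≡ false) → anyL p xs ≡ false
anyL-false⁺ p []       _    = refl
anyL-false⁺ p (x ∷ xs) none rewrite none x = anyL-false⁺ p xs none

∈-allSubsets : ∀ {n} (V : Subset n) → V ∈ allSubsets n
∈-allSubsets []          = here refl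
∈-allSubsets (false ∷ V) = ∈-++⁺ˡ (∈-map⁺ (false ∷_) (∈-allSubsets V))
∈-allSubsets (true  ∷ V) = ∈-++⁺ʳ (map (false ∷_) (allSubsets _)) (∈-map⁺ (true ∷_) (∈-allSubsets V))

⊆ᵇ-true⁻ : ∀ {n} (U T : Subset n) → (U ⊆ᵇ T) ≡ true → lookup U ⊆ lookup T
⊆ᵇ-true⁻ U T U⊆ᵇT i Ui with lookup T i | allFin-true⁻ U⊆ᵇT i
... | Ti | implies rewrite Ui = implies

⊆ᵇ-true⁺ : ∀ {n} (U T : Subset n) → lookup U ⊆ lookup T → (U ⊆ᵇ T) ≡ true
⊆ᵇ-true⁺ U T U⊆T = allFin-true⁺ implies
  where
  implies : ∀ i → not (lookup U i) ∨ lookup T i ≡ true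
  implies i with lookup U i in Ui
  ... | true  = U⊆T i Ui
  ... | false = refl

not-true⁻ : ∀ {b} → not b ≡ true → b ≡ false
not-true⁻ {false} _ = refl

not-false⁻ : ∀ {b} → not b ≡ false → b ≡ true
not-false⁻ {true} _ = refl

private
  isDependence : ∀ {n} → Matrix n → Subset n → Subset n → Subset n → Bool
  isDependence M S T U =
    (U ⊆ᵇ T) ∧ nonemptyᵇ U ∧ allFin (λ c → not (c ∈ᵇ S) ∨ not (rowSum M (lookup U) c))

rowsIndependent-sound : ∀ {n} (M : Matrix n) (S T : Subset n) →
                        rowsIndependent M S T ≡ true → Independent M (lookup S) (lookup T)
rowsIndependent-sound {n} M S T indep U U⊆T (i , Ui) =
  let c , c∉S∨sum≡false = allFin-false⁻ (third V⊆ᵇT V≠∅ notDependence)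
      Sc , sum≡true = both c∉S∨sum≡false
  in c , Sc , ≡.trans (rowSum-cong M (λ j → ≡.sym (lookup∘tabulate U j)) c) sum≡true
  where
  V = tabulate U
  notDependence : isDependence M S T V ≡ false
  notDependence = anyL-false⁻ (isDependence M S T) (not-true⁻ indep) (∈-allSubsets V)
  V⊆ᵇT : (V ⊆ᵇ T) ≡ true
  V⊆ᵇT = ⊆ᵇ-true⁺ V T (λ j Vj → U⊆T j (≡.trans (≡.sym (lookup∘tabulate U j)) Vj))
  V≠∅ : nonemptyᵇ V ≡ true
  V≠∅ = anyFin-true⁺ i (≡.trans (lookup∘tabulate U i) Ui)
  third : ∀ {a b c} → a ≡ true → b ≡ true → a ∧ b ∧ c ≡ false → c ≡ false
  third refl refl c≡false = c≡false
  both : ∀ {a b} → not a ∨ not b ≡ false → a ≡ true × b ≡ true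
  both {true} {true} _ = refl , refl

rowsIndependent-complete : ∀ {n} (M : Matrix n) (S T : Subset n) →
                           Independent M (lookup S) (lookup T) → rowsIndependent M S T ≡ true
rowsIndependent-complete {n} M S T ind = cong not (anyL-false⁺ (isDependence M S T) (allSubsets n) noDependence)
  where
  noDependence : ∀ V → isDependence M S T V ≡ false
  noDependence V with V ⊆ᵇ T in V⊆T | nonemptyᵇ V in V≠∅
  ... | false | _     = refl
  ... | true  | false = refl
  ... | true  | true  = allFin-false⁺ c (falsified Sc sum≡true)
    where
    witness = ind (lookup V) (⊆ᵇ-true⁻ V T V⊆T) (anyFin-true⁻ V≠∅)
    c = proj₁ witness
    Sc = proj₁ (proj₂ witness)
    sum≡true = proj₂ (proj₂ witness)
    falsified : ∀ {a b} → a ≡ true → b ≡ true → not a ∨ not b ≡ false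
    falsified refl refl = refl

rowsIndependent-false : ∀ {n} (M : Matrix n) (S T : Subset n) →
                        rowsIndependent M S T ≡ false → Dependent M (lookup S) (lookup T)
rowsIndependent-false {n} M S T dep with anyL-true⁻ (isDependence M S T) (allSubsets n) (not-false⁻ dep)
... | V , isDep with V ⊆ᵇ T in V⊆T | nonemptyᵇ V in V≠∅ | isDep
...   | true | true | vanishing =
  lookup V , ⊆ᵇ-true⁻ V T V⊆T , anyFin-true⁻ V≠∅ ,
  λ c Sc → zero-column (allFin-true⁻ vanishing c) Sc
  where
  zero-column : ∀ {a b} → not a ∨ not b ≡ true → a ≡ true → b ≡ false
  zero-column {true} {false} _ _ = refl

independent-or-dependent : ∀ {n} (M : Matrix n) (C T : Sub n) → Independent M C T ⊎ Dependent M C T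
independent-or-dependent M C T with rowsIndependent M (tabulate C) (tabulate T) in indep
... | true  = inj₁ (Independent-antitone M (≗⇒⊆ (≡.sym ∘ lookup∘tabulate T))
                   (Independent-monotone M (≗⇒⊆ (lookup∘tabulate C))
                     (rowsIndependent-sound M (tabulate C) (tabulate T) indep)))
... | false =
  let U , U⊆T , U≠∅ , vanishing = rowsIndependent-false M (tabulate C) (tabulate T) indep
  in inj₂ (U , (λ i → ≗⇒⊆ (lookup∘tabulate T) i ∘ U⊆T i) , U≠∅ ,
     λ c Cc → vanishing c (≡.trans (lookup∘tabulate C c) Cc))

maxL-upper : ∀ {x} (xs : List ℕ) → x ∈ xs → x ≤ maxL xs
maxL-upper (y ∷ xs) (here refl)  = m≤m⊔n y (maxL xs)
maxL-upper (y ∷ xs) (there x∈xs) = ≤-trans (maxL-upper xs x∈xs) (m≤n⊔m y (maxL xs))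

maxL-attained : (xs : List ℕ) → maxL xs ≡ 0 ⊎ maxL xs ∈ xs
maxL-attained []       = inj₁ refl
maxL-attained (y ∷ xs) with ⊔-sel y (maxL xs) | maxL-attained xs
... | inj₁ y⊔m≡y | _            = inj₂ (here y⊔m≡y)
... | inj₂ y⊔m≡m | inj₂ m∈xs    = inj₂ (there (≡.subst (_∈ xs) (≡.sym y⊔m≡m) m∈xs))
... | inj₂ y⊔m≡m | inj₁ m≡0     = inj₁ (≡.trans y⊔m≡m m≡0)

count-cong : ∀ {n} {T T' : Sub n} → (∀ i → T i ≡ T' i) → count T ≡ count T'
count-cong T≗T' = NatSum.sum-cong-≗ (cong χ ∘ T≗T')

count-∅ : ∀ {n} → count {n} (λ _ → false) ≡ 0
count-∅ {n} = NatSum.sum-vanishing {n} (λ _ → 0) (λ _ → refl)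

IndependentIn-∅ : ∀ {n} (M : Matrix n) (S : Sub n) → IndependentIn M S (λ _ → false)
IndependentIn-∅ M S = (λ _ ()) , λ { U U⊆∅ (i , Ui) → contradiction (U⊆∅ i Ui) λ () }

count≤rank : ∀ {n} (M : Matrix n) (S : Subset n) {T : Sub n} → IndependentIn M (lookup S) T → count T ≤ rankF2 M S
count≤rank {n} M S {T} (T⊆S , ind) = begin
  count T                                            ≡⟨ count-cong (≡.sym ∘ lookup∘tabulate T) ⟩
  count (lookup V)                                   ≡⟨ card≡count V ⟨
  ∣ V ∣                                              ≡⟨ cong (λ b → if b then ∣ V ∣ else 0) V-independent ⟨
  (if (V ⊆ᵇ S) ∧ rowsIndependent M S V then ∣ V ∣ else 0) ≤⟨ maxL-upper _ (∈-map⁺ _ (∈-allSubsets V)) ⟩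
  rankF2 M S                                         ∎
  where
  open ≤-Reasoning
  V = tabulate T
  V⊆T : lookup V ⊆ T
  V⊆T = ≗⇒⊆ (lookup∘tabulate T)
  V-independent : (V ⊆ᵇ S) ∧ rowsIndependent M S V ≡ true
  V-independent rewrite ⊆ᵇ-true⁺ V S (λ i → T⊆S i ∘ V⊆T i) =
    rowsIndependent-complete M S V (Independent-antitone M V⊆T ind)

rank-attained : ∀ {n} (M : Matrix n) (S : Subset n) → ∃ λ T → IndependentIn M (lookup S) T × rankF2 M S ≡ count T
rank-attained {n} M S with maxL-attained (map value (allSubsets n))
  where
  value : Subset n → ℕ
  value T = if (T ⊆ᵇ S) ∧ rowsIndependent M S T then ∣ T ∣ else 0
... | inj₁ rank≡0  = _ , IndependentIn-∅ M (lookup S) , ≡.trans rank≡0 (≡.sym (count-∅ {n}))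
... | inj₂ rank∈xs with ∈-map⁻ _ rank∈xs
...   | V , _ , rank≡value with (V ⊆ᵇ S) in V⊆S | rowsIndependent M S V in indep
...     | true  | true  = lookup V , (⊆ᵇ-true⁻ V S V⊆S , rowsIndependent-sound M S V indep) ,
                          ≡.trans rank≡value (card≡count V)
...     | true  | false = _ , IndependentIn-∅ M (lookup S) , ≡.trans rank≡value (≡.sym (count-∅ {n}))
...     | false | _     = _ , IndependentIn-∅ M (lookup S) , ≡.trans rank≡value (≡.sym (count-∅ {n}))

rank-compare : ∀ {n n'} (M : Matrix n) (S : Subset n) (M' : Matrix n') (S' : Subset n') (j k : ℕ) →
  (∀ T → IndependentIn M (lookup S) T → ∃ λ T' → IndependentIn M' (lookup S') T' × count T + j ≤ count T' + k) →
  rankF2 M S + j ≤ rankF2 M' S' + k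
rank-compare M S M' S' j k transfer =
  let T , T-ind , rank≡count = rank-attained M S
      T' , T'-ind , bound = transfer T T-ind
  in ≤-trans (≤-reflexive (cong (_+ j) rank≡count)) (≤-trans bound (+-monoˡ-≤ k (count≤rank M' S' T'-ind)))

module Relabelling {n n'} (M : Matrix n) (M' : Matrix n') (e : Fin n → Fin n')
                  (e-inj : ∀ {i j} → e i ≡ e j → i ≡ j) (e-hom : ∀ i j → M' (e i) (e j) ≡ M i j) where

  InImage : Sub n' → Set
  InImage U = ∀ j → U j ≡ true → ∃ λ i → e i ≡ j

  private
    vanishes-off-image : ∀ {U : Sub n'} → InImage U → ∀ j → U j ≡ false ⊎ ∃ λ i → e i ≡ j
    vanishes-off-image {U} U-im j with U j in Uj
    ... | false = inj₁ refl
    ... | true  = inj₂ (U-im j Uj)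

  count-relabel : ∀ {U : Sub n'} → InImage U → count U ≡ count (U ∘ e)
  count-relabel U-im = NatSum.sum-reindex e e-inj _ (map₁ (cong χ) ∘ vanishes-off-image U-im)

  rowSum-relabel : ∀ {U : Sub n'} → InImage U → ∀ c → rowSum M' U (e c) ≡ rowSum M (U ∘ e) c
  rowSum-relabel {U} U-im c = begin
    rowSum M' U (e c)                          ≡⟨ rowSum≡sum M' U (e c) ⟩
    XorSum.sum (λ j → U j ∧ M' j (e c))
      ≡⟨ XorSum.sum-reindex e e-inj _ (map₁ (cong (_∧ M' _ (e c))) ∘ vanishes-off-image U-im) ⟩
    XorSum.sum (λ i → U (e i) ∧ M' (e i) (e c)) ≡⟨ XorSum.sum-cong-≗ (λ i → cong (U (e i) ∧_) (e-hom i c)) ⟩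
    XorSum.sum (λ i → U (e i) ∧ M i c)         ≡⟨ rowSum≡sum M (U ∘ e) c ⟨
    rowSum M (U ∘ e) c                         ∎
    where open ≡-Reasoning

  image : Sub n → Sub n'
  image T j = anyFin (λ i → T i ∧ does (e i ≟ j))

  image⁻ : ∀ T j → image T j ≡ true → ∃ λ i → T i ≡ true × e i ≡ j
  image⁻ T j inImage with anyFin-true⁻ inImage
  ... | i , Ti∧ei≡j with T i in Ti | e i ≟ j
  ...   | true | yes ei≡j = i , Ti , ei≡j

  image-InImage : ∀ T → InImage (image T)
  image-InImage T j inImage = let i , _ , ei≡j = image⁻ T j inImage in i , ei≡j

  image-∘ : ∀ T i → image T (e i) ≡ T i
  image-∘ T i with T i in Ti
  ... | true  = anyFin-true⁺ i (cong₂ _∧_ Ti (dec-true (e i ≟ e i) refl))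
  ... | false with image T (e i) in inImage
  ...   | false = refl
  ...   | true  = let k , Tk , ek≡ei = image⁻ T (e i) inImage
                  in contradiction (≡.trans (≡.sym Tk) (≡.trans (cong T (e-inj ek≡ei)) Ti)) λ ()

  module _ (S : Subset n) (S' : Subset n') (S'∘e : ∀ i → lookup S' (e i) ≡ lookup S i)
           (S'-im : InImage (lookup S')) where

    image-IndependentIn : ∀ T → IndependentIn M (lookup S) T → IndependentIn M' (lookup S') (image T)
    image-IndependentIn T (T⊆S , ind) = image⊆S' , ind'
      where
      image⊆S' : image T ⊆ lookup S'
      image⊆S' j inImage with image⁻ T j inImage
      ... | i , Ti , refl = ≡.trans (S'∘e i) (T⊆S i Ti)
      ind' : Independent M' (lookup S') (image T)
      ind' U U⊆image (j , Uj) with image⁻ T j (U⊆image j Uj)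
      ... | i , _ , refl =
        let U-im = λ k Uk → image-InImage T k (U⊆image k Uk)
            c , Sc , sum≡true = ind (U ∘ e) (λ k Uek → ≡.trans (≡.sym (image-∘ T k)) (U⊆image (e k) Uek)) (i , Uj)
        in e c , ≡.trans (S'∘e c) Sc , ≡.trans (rowSum-relabel U-im c) sum≡true

    preimage-IndependentIn : ∀ T' → IndependentIn M' (lookup S') T' → IndependentIn M (lookup S) (T' ∘ e)
    preimage-IndependentIn T' (T'⊆S' , ind') = (λ i T'ei → ≡.trans (≡.sym (S'∘e i)) (T'⊆S' (e i) T'ei)) , ind
      where
      ind : Independent M (lookup S) (T' ∘ e)
      ind U U⊆T (i , Ui) with ind' (image U) image⊆T' (e i , ≡.trans (image-∘ U i) Ui)
        where
        image⊆T' : image U ⊆ T'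
        image⊆T' j inImage with image⁻ U j inImage
        ... | k , Uk , refl = U⊆T k Uk
      ... | c' , S'c' , sum≡true with S'-im c' S'c'
      ...   | c , refl = c , ≡.trans (≡.sym (S'∘e c)) S'c' ,
                         ≡.trans (rowSum-cong M (≡.sym ∘ image-∘ U) c)
                                 (≡.trans (≡.sym (rowSum-relabel (image-InImage U) c)) sum≡true)

    rank-relabel : rankF2 M S ≡ rankF2 M' S'
    rank-relabel = ≤-antisym (+-cancelʳ-≤ 0 _ _ (rank-compare M S M' S' 0 0 forward))
                             (+-cancelʳ-≤ 0 _ _ (rank-compare M' S' M S 0 0 backward))
      where
      forward : ∀ T → IndependentIn M (lookup S) T →
                ∃ λ T' → IndependentIn M' (lookup S') T' × count T + 0 ≤ count T' + 0
      forward T T-ind = image T , image-IndependentIn T T-ind ,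
        ≤-reflexive (cong (_+ 0) (≡.sym (≡.trans (count-relabel (image-InImage T)) (count-cong (image-∘ T)))))
      backward : ∀ T' → IndependentIn M' (lookup S') T' →
                 ∃ λ T → IndependentIn M (lookup S) T × count T' + 0 ≤ count T + 0
      backward T' T'-ind = T' ∘ e , preimage-IndependentIn T' T'-ind ,
        ≤-reflexive (cong (_+ 0) (count-relabel (λ j T'j → S'-im j (proj₁ T'-ind j T'j))))

-- If T depends on C ∖ x, a dependency U uses column x; then T ∖ t is independent on C ∖ x for any
-- row t of U, as a dependency U' of T ∖ t would make U xor U' vanish on all of C.

drop-column : ∀ {n} (M : Matrix n) (C T : Sub n) x → Independent M C T →
              ∃ λ T₀ → T₀ ⊆ T × count T ≤ suc (count T₀) × Independent M (C ∖ x) T₀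
drop-column M C T x ind with independent-or-dependent M (C ∖ x) T
... | inj₁ ind' = T , (λ _ Ti → Ti) , n≤1+n _ , ind'
... | inj₂ (U , U⊆T , (t , Ut) , vanishing) =
  T ∖ t , ∖-⊆ T t , ≤-reflexive (≡.trans (count-∖ T t) (cong (λ b → χ b + count (T ∖ t)) (U⊆T t Ut))) , ind₀
  where
  U-at-x : rowSum M U x ≡ true
  U-at-x with ind U U⊆T (t , Ut)
  ... | c , Cc , sum≡true with c ≟ x
  ...   | yes refl = sum≡true
  ...   | no c≢x   = contradiction (≡.trans (≡.sym sum≡true) (vanishing c (∖-true C Cc c≢x))) λ ()
  ind₀ : Independent M (C ∖ x) (T ∖ t)
  ind₀ U' U'⊆T∖t U'≠∅ with ind (λ i → U i xor U' i) W⊆T (t , W-at-t)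
    where
    W⊆T : (λ i → U i xor U' i) ⊆ T
    W⊆T i Wi with U i in Ui
    ... | true  = U⊆T i Ui
    ... | false = ∖-⊆ T t i (U'⊆T∖t i Wi)
    W-at-t : U t xor U' t ≡ true
    W-at-t with U' t in U't
    ... | false = ≡.trans (xor-identityʳ (U t)) Ut
    ... | true  = contradiction (≡.trans (≡.sym (U'⊆T∖t t U't)) (∖-self T t)) λ ()
  ... | d , Cd , W-sum with rowSum-xor M U U' d | d ≟ x
  ...   | split | no d≢x = d , ∖-true C Cd d≢x , U'-sum
    where
    U'-sum : rowSum M U' d ≡ true
    U'-sum rewrite vanishing d (∖-true C Cd d≢x) = ≡.trans (≡.sym split) W-sum
  ...   | split | yes refl with ind U' (λ i → ∖-⊆ T t i ∘ U'⊆T∖t i) U'≠∅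
  ...     | c , Cc , U'-sum with c ≟ x
  ...       | no c≢x   = c , ∖-true C Cc c≢x , U'-sum
  ...       | yes refl = contradiction (≡.trans (≡.sym U'-sum) U'-at-x) λ ()
    where
    U'-at-x : rowSum M U' x ≡ false
    U'-at-x with rowSum M U' x | ≡.trans (≡.sym split) W-sum
    ... | false | _ = refl
    ... | true  | U-sum rewrite U-at-x = contradiction U-sum λ ()

module AdjacentTwins {n} (M : Matrix n) (M-sym : ∀ i j → M i j ≡ M j i) (S : Subset n) (p q : Fin n)
  (p≢q : p ≢ q) (S-p : lookup S p ≡ false) (S-q : lookup S q ≡ false)
  (twins : ∀ c → lookup S c ≡ true → M p c ≡ M q c)
  (M-pq : M p q ≡ true) (M-pp : M p p ≡ false) (M-qq : M q q ≡ false) where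

  _⁺ : Sub n → Sub n
  U ⁺ = insert p (insert q U)

  _⁻ : Sub n → Sub n
  U ⁻ = U ∖ p ∖ q

  data Position (j : Fin n) : Set where
    at-p      : j ≡ p → Position j
    at-q      : j ≡ q → Position j
    elsewhere : j ≢ p → j ≢ q → Position j

  position : ∀ j → Position j
  position j with j ≟ p | j ≟ q
  ... | yes j≡p | _       = at-p j≡p
  ... | no _    | yes j≡q = at-q j≡q
  ... | no j≢p  | no j≢q  = elsewhere j≢p j≢q

  q≢p : q ≢ p
  q≢p = p≢q ∘ ≡.sym

  ⁻-p : ∀ U → (U ⁻) p ≡ false
  ⁻-p U = ≡.trans (∖-other (U ∖ p) p≢q) (∖-self U p)

  ⁻-q : ∀ U → (U ⁻) q ≡ false
  ⁻-q U = ∖-self (U ∖ p) q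

  ⁻-elsewhere : ∀ U {j} → j ≢ p → j ≢ q → (U ⁻) j ≡ U j
  ⁻-elsewhere U j≢p j≢q = ≡.trans (∖-other (U ∖ p) j≢q) (∖-other U j≢p)

  ⁻-⊆ : ∀ U → U ⁻ ⊆ U
  ⁻-⊆ U j = ∖-⊆ U p j ∘ ∖-⊆ (U ∖ p) q j

  ⁺-p : ∀ U → (U ⁺) p ≡ true
  ⁺-p U = insert-self (insert q U) p

  ⁺-q : ∀ U → (U ⁺) q ≡ true
  ⁺-q U = ≡.trans (insert-other (insert q U) q≢p) (insert-self U q)

  ⁺-elsewhere : ∀ U {j} → j ≢ p → j ≢ q → (U ⁺) j ≡ U j
  ⁺-elsewhere U j≢p j≢q = ≡.trans (insert-other (insert q U) j≢p) (insert-other U j≢q)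

  S⁺-cases : ∀ c → (lookup S ⁺) c ≡ true → lookup S c ≡ true ⊎ c ≡ p ⊎ c ≡ q
  S⁺-cases c S⁺c with position c
  ... | at-p c≡p          = inj₂ (inj₁ c≡p)
  ... | at-q c≡q          = inj₂ (inj₂ c≡q)
  ... | elsewhere c≢p c≢q = inj₁ (≡.trans (≡.sym (⁺-elsewhere (lookup S) c≢p c≢q)) S⁺c)

  S⊆S⁺ : lookup S ⊆ lookup S ⁺
  S⊆S⁺ c Sc with position c
  ... | at-p refl         = contradiction (≡.trans (≡.sym Sc) S-p) λ ()
  ... | at-q refl         = contradiction (≡.trans (≡.sym Sc) S-q) λ ()
  ... | elsewhere c≢p c≢q = ≡.trans (⁺-elsewhere (lookup S) c≢p c≢q) Sc

  ⁻-⊆-S : ∀ {T} → T ⊆ lookup S ⁺ → T ⁻ ⊆ lookup S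
  ⁻-⊆-S {T} T⊆S⁺ j T⁻j with position j
  ... | at-p refl         = contradiction (≡.trans (≡.sym T⁻j) (⁻-p T)) λ ()
  ... | at-q refl         = contradiction (≡.trans (≡.sym T⁻j) (⁻-q T)) λ ()
  ... | elsewhere j≢p j≢q =
    ≡.trans (≡.sym (⁺-elsewhere (lookup S) j≢p j≢q)) (T⊆S⁺ j (≡.trans (≡.sym (⁻-elsewhere T j≢p j≢q)) T⁻j))

  rowSum-⁻ : ∀ U c → rowSum M U c ≡ (U p ∧ M p c) xor ((U q ∧ M q c) xor rowSum M (U ⁻) c)
  rowSum-⁻ U c = ≡.trans (rowSum-∖ M U p c) (cong ((U p ∧ M p c) xor_)
    (≡.trans (rowSum-∖ M (U ∖ p) q c) (cong (λ b → (b ∧ M q c) xor rowSum M (U ⁻) c) (∖-other U q≢p))))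

  count-⁻ : ∀ T → count T ≡ χ (T p) + (χ (T q) + count (T ⁻))
  count-⁻ T = ≡.trans (count-∖ T p) (cong (χ (T p) +_)
    (≡.trans (count-∖ (T ∖ p) q) (cong (λ b → χ b + count (T ⁻)) (∖-other T q≢p))))

  ⊆S⇒false : ∀ {U} → U ⊆ lookup S → ∀ {j} → lookup S j ≡ false → U j ≡ false
  ⊆S⇒false {U} U⊆S {j} Sj with U j in Uj
  ... | false = refl
  ... | true  = contradiction (≡.trans (≡.sym (U⊆S j Uj)) Sj) λ ()

  ⁺⁻-≗ : ∀ {U} → U ⊆ lookup S → ∀ j → ((U ⁺) ⁻) j ≡ U j
  ⁺⁻-≗ {U} U⊆S j with position j
  ... | at-p refl         = ≡.trans (⁻-p (U ⁺)) (≡.sym (⊆S⇒false U⊆S S-p))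
  ... | at-q refl         = ≡.trans (⁻-q (U ⁺)) (≡.sym (⊆S⇒false U⊆S S-q))
  ... | elsewhere j≢p j≢q = ≡.trans (⁻-elsewhere (U ⁺) j≢p j≢q) (⁺-elsewhere U j≢p j≢q)

  M-qp : M q p ≡ true
  M-qp = ≡.trans (M-sym q p) M-pq

  columns-agree : ∀ {U} → U ⊆ lookup S → rowSum M U p ≡ rowSum M U q
  columns-agree {U} U⊆S = begin
    rowSum M U p                   ≡⟨ rowSum≡sum M U p ⟩
    XorSum.sum (λ i → U i ∧ M i p) ≡⟨ XorSum.sum-cong-≗ agree ⟩
    XorSum.sum (λ i → U i ∧ M i q) ≡⟨ rowSum≡sum M U q ⟨
    rowSum M U q                   ∎
    where
    open ≡-Reasoning
    agree : ∀ i → U i ∧ M i p ≡ U i ∧ M i q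
    agree i with U i in Ui
    ... | false = refl
    ... | true  = ≡.trans (M-sym i p) (≡.trans (twins i (U⊆S i Ui)) (M-sym q i))

  rowSum-⁺ : ∀ {U} → U ⊆ lookup S → ∀ c → rowSum M (U ⁺) c ≡ M p c xor (M q c xor rowSum M U c)
  rowSum-⁺ {U} U⊆S c = ≡.trans (rowSum-⁻ (U ⁺) c)
    (cong₃ (λ a b r → (a ∧ M p c) xor ((b ∧ M q c) xor r)) (⁺-p U) (⁺-q U) (rowSum-cong M (⁺⁻-≗ U⊆S) c))
    where
    cong₃ : ∀ {A : Set} (f : Bool → Bool → Bool → A) {a a' b b' r r'} →
            a ≡ a' → b ≡ b' → r ≡ r' → f a b r ≡ f a' b' r'
    cong₃ f refl refl refl = refl

  rowSum-at-p : ∀ U → rowSum M U p ≡ U q xor rowSum M (U ⁻) p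
  rowSum-at-p U = ≡.trans (rowSum-⁻ U p)
    (cong₂ (λ x y → x xor (y xor rowSum M (U ⁻) p))
      (≡.trans (cong (U p ∧_) M-pp) (∧-zeroʳ (U p))) (≡.trans (cong (U q ∧_) M-qp) (∧-identityʳ (U q))))

  rowSum-at-q : ∀ U → rowSum M U q ≡ U p xor rowSum M (U ⁻) q
  rowSum-at-q U = ≡.trans (rowSum-⁻ U q)
    (cong₂ (λ x y → x xor (y xor rowSum M (U ⁻) q))
      (≡.trans (cong (U p ∧_) M-pq) (∧-identityʳ (U p))) (≡.trans (cong (U q ∧_) M-qq) (∧-zeroʳ (U q))))

  ⁺-IndependentIn : ∀ {T} → IndependentIn M (lookup S) T → IndependentIn M (lookup S ⁺) (T ⁺)
  ⁺-IndependentIn {T} (T⊆S , ind) = T⁺⊆S⁺ , ind⁺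
    where
    T⁺⊆S⁺ : T ⁺ ⊆ lookup S ⁺
    T⁺⊆S⁺ j T⁺j with position j
    ... | at-p refl         = ⁺-p (lookup S)
    ... | at-q refl         = ⁺-q (lookup S)
    ... | elsewhere j≢p j≢q =
      ≡.trans (⁺-elsewhere (lookup S) j≢p j≢q) (T⊆S j (≡.trans (≡.sym (⁺-elsewhere T j≢p j≢q)) T⁺j))

    ⁻⊆T : ∀ {U} → U ⊆ T ⁺ → U ⁻ ⊆ T
    ⁻⊆T {U} U⊆T⁺ j U⁻j with position j
    ... | at-p refl         = contradiction (≡.trans (≡.sym U⁻j) (⁻-p U)) λ ()
    ... | at-q refl         = contradiction (≡.trans (≡.sym U⁻j) (⁻-q U)) λ ()
    ... | elsewhere j≢p j≢q = ≡.trans (≡.sym (⁺-elsewhere T j≢p j≢q))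
                                (U⊆T⁺ j (≡.trans (≡.sym (⁻-elsewhere U j≢p j≢q)) U⁻j))

    ⁻-nonempty : ∀ {U} → Nonempty U → U p ≡ rowSum M (U ⁻) p → U q ≡ rowSum M (U ⁻) p → Nonempty (U ⁻)
    ⁻-nonempty {U} (i , Ui) Up≡α Uq≡α with U p in Up
    ... | true  = rowSum-nonempty M (U ⁻) p (≡.sym Up≡α)
    ... | false with position i
    ...   | at-p refl         = contradiction (≡.trans (≡.sym Ui) Up) λ ()
    ...   | at-q refl         = contradiction (≡.trans (≡.sym Ui) (≡.trans Uq≡α (≡.sym Up≡α))) λ ()
    ...   | elsewhere i≢p i≢q = i , ≡.trans (⁻-elsewhere U i≢p i≢q) Ui

    ⁻-column : ∀ {U} → U q ≡ U p → ∀ c → lookup S c ≡ true → rowSum M U c ≡ rowSum M (U ⁻) c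
    ⁻-column {U} Uq≡Up c Sc = ≡.trans (rowSum-⁻ U c)
      (≡.trans (cong₂ (λ b m → (U p ∧ M p c) xor ((b ∧ m) xor rowSum M (U ⁻) c)) Uq≡Up (≡.sym (twins c Sc)))
               (xor-cancel (U p ∧ M p c) (rowSum M (U ⁻) c)))

    ind⁺ : Independent M (lookup S ⁺) (T ⁺)
    ind⁺ U U⊆T⁺ U≠∅ with xor-cases (U p) (U q) (rowSum M (U ⁻) p)
    ... | inj₁ p-col        = p , ⁺-p (lookup S) , ≡.trans (rowSum-at-p U) p-col
    ... | inj₂ (inj₁ q-col) = q , ⁺-q (lookup S) ,
      ≡.trans (rowSum-at-q U)
              (≡.trans (cong (U p xor_) (≡.sym (columns-agree (λ j → T⊆S j ∘ ⁻⊆T U⊆T⁺ j)))) q-col)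
    ... | inj₂ (inj₂ (Up≡α , Uq≡α)) =
      let c , Sc , U⁻-col = ind (U ⁻) (⁻⊆T U⊆T⁺) (⁻-nonempty U≠∅ Up≡α Uq≡α)
      in c , S⊆S⁺ c Sc , ≡.trans (⁻-column (≡.trans Uq≡α (≡.sym Up≡α)) c Sc) U⁻-col

  ⁻-Independent-p : ∀ {T} → IndependentIn M (lookup S ⁺) T → Independent M (insert p (lookup S)) (T ⁻)
  ⁻-Independent-p {T} (T⊆S⁺ , ind) U U⊆T⁻ U≠∅ with ind U (λ j → ⁻-⊆ T j ∘ U⊆T⁻ j) U≠∅
  ... | c , S⁺c , U-col with S⁺-cases c S⁺c
  ...   | inj₁ Sc          = c , insert-⊆ (lookup S) p c Sc , U-col
  ...   | inj₂ (inj₁ refl) = p , insert-self (lookup S) p , U-col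
  ...   | inj₂ (inj₂ refl) = p , insert-self (lookup S) p ,
                             ≡.trans (columns-agree (λ j → ⁻-⊆-S T⊆S⁺ j ∘ U⊆T⁻ j)) U-col

  ⁻-Independent : ∀ {T} → IndependentIn M (lookup S ⁺) T → T p ≡ true → T q ≡ true →
                  Independent M (lookup S) (T ⁻)
  ⁻-Independent {T} (T⊆S⁺ , ind) Tp Tq U U⊆T⁻ U≠∅ = from-U⁺ (ind (U ⁺) U⁺⊆T (p , ⁺-p U))
    where
    U⊆S : U ⊆ lookup S
    U⊆S j = ⁻-⊆-S T⊆S⁺ j ∘ U⊆T⁻ j
    U⊆T : U ⊆ T
    U⊆T j = ⁻-⊆ T j ∘ U⊆T⁻ j
    U⁺⊆T : U ⁺ ⊆ T
    U⁺⊆T j U⁺j with position j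
    ... | at-p refl         = Tp
    ... | at-q refl         = Tq
    ... | elsewhere j≢p j≢q = U⊆T j (≡.trans (≡.sym (⁺-elsewhere U j≢p j≢q)) U⁺j)
    rowSum-⁺-at : ∀ c {a b} → M p c ≡ a → M q c ≡ b → rowSum M (U ⁺) c ≡ a xor (b xor rowSum M U c)
    rowSum-⁺-at c refl refl = rowSum-⁺ U⊆S c
    from-U : rowSum M U p ≡ false → ∃ λ c → lookup S c ≡ true × rowSum M U c ≡ true
    from-U U-p with ind U U⊆T U≠∅
    ... | c , S⁺c , U-col with S⁺-cases c S⁺c
    ...   | inj₁ Sc          = c , Sc , U-col
    ...   | inj₂ (inj₁ refl) = contradiction (≡.trans (≡.sym U-col) U-p) λ ()
    ...   | inj₂ (inj₂ refl) = contradiction (≡.trans (≡.sym U-col) (≡.trans (≡.sym (columns-agree U⊆S)) U-p)) λ ()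
    from-U⁺ : (∃ λ c → (lookup S ⁺) c ≡ true × rowSum M (U ⁺) c ≡ true) →
              ∃ λ c → lookup S c ≡ true × rowSum M U c ≡ true
    from-U⁺ (c , S⁺c , U⁺-col) with S⁺-cases c S⁺c
    ... | inj₁ Sc          = c , Sc ,
      ≡.trans (≡.sym (xor-cancel (M q c) (rowSum M U c))) (≡.trans (≡.sym (rowSum-⁺-at c (twins c Sc) refl)) U⁺-col)
    ... | inj₂ (inj₁ refl) = from-U (not-true⁻ (≡.trans (≡.sym (rowSum-⁺-at p M-pp M-qp)) U⁺-col))
    ... | inj₂ (inj₂ refl) =
      from-U (≡.trans (columns-agree U⊆S) (not-true⁻ (≡.trans (≡.sym (rowSum-⁺-at q M-pq M-qq)) U⁺-col)))

  ⁻-via-column-drop : ∀ {T} → IndependentIn M (lookup S ⁺) T → count T ≤ suc (count (T ⁻)) →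
                      ∃ λ T₀ → IndependentIn M (lookup S) T₀ × count T + 0 ≤ count T₀ + 2
  ⁻-via-column-drop {T} T-ind T≤ with drop-column M (insert p (lookup S)) (T ⁻) p (⁻-Independent-p T-ind)
  ... | T₀ , T₀⊆T⁻ , T⁻≤ , ind₀ =
    T₀ , ((λ j → ⁻-⊆-S (proj₁ T-ind) j ∘ T₀⊆T⁻ j) , Independent-monotone M (insert-∖-⊆ (lookup S) p) ind₀) ,
    bound
    where
    open ≤-Reasoning
    bound : count T + 0 ≤ count T₀ + 2
    bound = begin
      count T + 0              ≡⟨ +-identityʳ (count T) ⟩
      count T                  ≤⟨ T≤ ⟩
      suc (count (T ⁻))        ≤⟨ s≤s T⁻≤ ⟩
      suc (suc (count T₀))     ≡⟨ +-comm 2 (count T₀) ⟩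
      count T₀ + 2             ∎

  -- With both twins in T, T ⁻ stays independent on S.  Otherwise T lost at most one row, and on the
  -- rows of T ⁻ column q repeats column p, so dropping column p as well costs at most one more row.
  ⁻-bound : ∀ T → IndependentIn M (lookup S ⁺) T →
            ∃ λ T₀ → IndependentIn M (lookup S) T₀ × count T + 0 ≤ count T₀ + 2
  ⁻-bound T T-ind with T p in Tp | T q in Tq | count-⁻ T
  ... | true  | true  | count≡ = T ⁻ , (⁻-⊆-S (proj₁ T-ind) , ⁻-Independent T-ind Tp Tq) ,
                                 ≤-reflexive (≡.trans (+-identityʳ (count T)) (≡.trans count≡ (+-comm 2 (count (T ⁻)))))
  ... | true  | false | count≡ = ⁻-via-column-drop T-ind (≤-reflexive count≡)
  ... | false | true  | count≡ = ⁻-via-column-drop T-ind (≤-reflexive count≡)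
  ... | false | false | count≡ = ⁻-via-column-drop T-ind (≤-trans (≤-reflexive count≡) (n≤1+n _))

  rank-twins : (S⁺ : Subset n) → (∀ j → lookup S⁺ j ≡ (lookup S ⁺) j) → rankF2 M S⁺ ≡ rankF2 M S + 2
  rank-twins S⁺ S⁺≗ = ≤-antisym
    (≤-trans (≤-reflexive (≡.sym (+-identityʳ _))) (rank-compare M S⁺ M S 0 2 λ T T-ind →
      ⁻-bound T (IndependentIn-monotone M (≗⇒⊆ S⁺≗) T-ind)))
    (≤-trans (rank-compare M S M S⁺ 2 0 λ T T-ind →
      T ⁺ , IndependentIn-monotone M (≗⇒⊆ (≡.sym ∘ S⁺≗)) (⁺-IndependentIn T-ind) , ≤-reflexive (⁺-count T-ind))
      (≤-reflexive (+-identityʳ _)))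
    where
    ⁺-count : ∀ {T} → IndependentIn M (lookup S) T → count T + 2 ≡ count (T ⁺) + 0
    ⁺-count {T} (T⊆S , _) = begin
      count T + 2                                         ≡⟨ +-comm (count T) 2 ⟩
      2 + count T                                         ≡⟨ cong (2 +_) (count-cong (⁺⁻-≗ T⊆S)) ⟨
      2 + count ((T ⁺) ⁻)                                 ≡⟨ cong₂ (λ a b → χ a + (χ b + count ((T ⁺) ⁻))) (⁺-p T) (⁺-q T) ⟨
      χ ((T ⁺) p) + (χ ((T ⁺) q) + count ((T ⁺) ⁻))      ≡⟨ count-⁻ (T ⁺) ⟨
      count (T ⁺)                                         ≡⟨ +-identityʳ (count (T ⁺)) ⟨
      count (T ⁺) + 0                                     ∎
      where open ≡-Reasoning

-- twinAdj tests j against v by a local recursion; removing vertex zero lets the induction follow it.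
twinAdj-v : ∀ {m} (G : Graph m) (v : Fin m) → twinAdj G v zero (suc v) ≡ true
twinAdj-v G zero    = refl
twinAdj-v G (suc v) = twinAdj-v (G ─ zero) v

twinAdj-other : ∀ {m} (G : Graph m) {v j : Fin m} → j ≢ v → twinAdj G v zero (suc j) ≡ adj G v j
twinAdj-other G {zero}  {zero}  j≢v = contradiction refl j≢v
twinAdj-other G {zero}  {suc j} _   = refl
twinAdj-other G {suc v} {zero}  _   = refl
twinAdj-other G {suc v} {suc j} j≢v = twinAdj-other (G ─ zero) (j≢v ∘ cong suc)

module TrueTwin {m} (G : Graph (suc m)) (v : Fin (suc m)) where

  G''' : Graph (suc (suc m))
  G''' = addTrueTwin G v

  rank-without-twin : ∀ S → rk G''' (false ∷ S) ≡ rk G S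
  rank-without-twin S = ≡.sym (Relabelling.rank-relabel (adj G) (adj G''') suc suc-injective (λ _ _ → refl)
    S (false ∷ S) (λ _ → refl) λ { (suc j) _ → j , refl })

  rank-without-v : ∀ S → rk G (insertAt S v false) ≡ rk (G ─ v) S
  rank-without-v S = ≡.sym (Relabelling.rank-relabel (adj (G ─ v)) (adj G) (punchIn v) (punchIn-injective v _ _)
    (λ _ _ → refl) S (insertAt S v false) (insertAt-punchIn S v false)
    λ j inS → punchOut (insertAt-false-≢ S v j inS ∘ ≡.sym) , punchIn-punchOut _)

  toTwin : Fin (suc m) → Fin (suc (suc m))
  toTwin j = if does (j ≟ v) then zero else suc j

  toTwin-v : toTwin v ≡ zero
  toTwin-v = cong (if_then zero else suc v) (dec-true (v ≟ v) refl)

  toTwin-other : ∀ {j} → j ≢ v → toTwin j ≡ suc j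
  toTwin-other {j} j≢v = cong (if_then zero else suc j) (dec-false (j ≟ v) j≢v)

  toTwin-injective : ∀ {i j} → toTwin i ≡ toTwin j → i ≡ j
  toTwin-injective {i} {j} eq with i ≟ v | j ≟ v
  ... | yes i≡v | yes j≡v = ≡.trans i≡v (≡.sym j≡v)
  ... | no  _   | no  _   = suc-injective eq

  toTwin-adj : ∀ i j → adj G''' (toTwin i) (toTwin j) ≡ adj G i j
  toTwin-adj i j with i ≟ v | j ≟ v
  ... | yes refl | yes refl = ≡.sym (loopless G v)
  ... | yes refl | no j≢v   = twinAdj-other G j≢v
  ... | no i≢v   | yes refl = ≡.trans (twinAdj-other G i≢v) (symmetric G v i)
  ... | no _     | no _     = refl

  rank-twin-replaces-v : ∀ S → rk G''' (true ∷ insertAt S v false) ≡ rk G (insertAt S v true)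
  rank-twin-replaces-v S = ≡.sym (Relabelling.rank-relabel (adj G) (adj G''') toTwin toTwin-injective toTwin-adj
    (insertAt S v true) (true ∷ insertAt S v false) on-image image)
    where
    on-image : ∀ i → lookup (true ∷ insertAt S v false) (toTwin i) ≡ lookup (insertAt S v true) i
    on-image i with i ≟ v
    ... | yes refl = ≡.sym (insertAt-lookup S v true)
    ... | no i≢v   = insertAt-other S false true i≢v
    image : ∀ j → lookup (true ∷ insertAt S v false) j ≡ true → ∃ λ i → toTwin i ≡ j
    image zero    _  = v , toTwin-v
    image (suc j) inS = j , toTwin-other (insertAt-false-≢ S v j inS)

  rank-without-both : ∀ S → rk G''' (false ∷ insertAt S v false) ≡ rk (G ─ v) S
  rank-without-both S = ≡.trans (rank-without-twin (insertAt S v false)) (rank-without-v S)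

  rank-with-both : ∀ S → rk G''' (true ∷ insertAt S v true) ≡ suc (suc (rk (G ─ v) S))
  rank-with-both S = ≡.trans (AdjacentTwins.rank-twins (adj G''') (symmetric G''') (false ∷ insertAt S v false) zero (suc v)
    (λ ()) refl (insertAt-lookup S v false) twins (twinAdj-v G v) refl (loopless G v) (true ∷ insertAt S v true) doubled)
    (≡.trans (cong (_+ 2) (rank-without-both S)) (+-comm _ 2))
    where
    twins : ∀ c → lookup (false ∷ insertAt S v false) c ≡ true → adj G''' zero c ≡ adj G''' (suc v) c
    twins (suc j) inS = twinAdj-other G (insertAt-false-≢ S v j inS)
    doubled : ∀ j → lookup (true ∷ insertAt S v true) j
                    ≡ insert zero (insert (suc v) (lookup (false ∷ insertAt S v false))) j
    doubled zero    = refl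
    doubled (suc j) with j ≟ v
    ... | yes refl = insertAt-lookup S v true
    ... | no j≢v   = insertAt-other S true false j≢v

-- The identity does not need v to be non-isolated.
proposition4p13 : {c ℓ : Level} (R : CommutativeRing c ℓ) (m : ℕ)
    (G : Graph (suc m)) (v : Fin (suc m)) → NonIsolated G v →
    (x y : CommutativeRing.Carrier R) →
    CommutativeRing._≈_ R (q R (addTrueTwin G v) x y)
      (CommutativeRing._+_ R
        (CommutativeRing._*_ R (CommutativeRing._+_ R (CommutativeRing.1# R) (CommutativeRing.1# R)) (q R G x y))
        (CommutativeRing._*_ R
          (CommutativeRing._+_ R (pow R (_minus1 R x) 2) (CommutativeRing.-_ R (CommutativeRing.1# R)))
          (q R (G ─ v) x y)))
proposition4p13 R m G v _ x y =
  Interlace.q-twin-recurrence x y v G''' G (G ─ v)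
    rank-without-both rank-twin-replaces-v rank-without-twin rank-with-both rank-without-v
  where
  open SubsetSums R
  open TrueTwin G v
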